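{- The Erdős–Faber–Lovász conjecture holds (i.e. every finite linear hypergraph with $v$ points admits a line coloring using at most $v$ colors) if and only if $\chi(G)\le v(G)$ for every finite graph $G$.
   Context: A linear hypergraph is a pair $\pi=(P,\mathcal L)$ with $P$ a finite set of points and $\mathcal L$ a set of subsets of $P$ (lines) such that any two distinct points lie in at most one line and every line has at least two points. A line coloring of $\pi$ is a map $c:\mathcal L\to\mathfrak C$ such that $c(l)\ne c(g)$ whenever $l\ne g$ and $l\cap g\neq\emptyset$. The intersection graph $G_\pi$ of $\pi$ has vertex set $\mathcal L$, two distinct lines being adjacent iff they intersect. For a finite simple graph $G$, the linear intersection number $v(G)$ is the minimum number $|P|$ of points of a linear hypergraph $\pi=(P,\mathcal L)$ whose intersection graph $G_\pi$ is isomorphic to $G$ (such $\pi$ always exists). $\chi(G)$ is the chromatic number. -}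

module Defs where

open import Data.Nat using (ℕ; _≤_)
open import Data.Fin using (Fin)
open import Data.Fin.Subset using (Subset; _∈_)
open import Data.Bool using (Bool; true; false)
open import Data.Product using (Σ; ∃; _×_; _,_)
open import Relation.Binary.PropositionalEquality using (_≡_; _≢_)
open import Relation.Nullary using (¬_)
open import Function.Bundles using (Bijection; _⤖_; _⇔_)
open import Function.Definitions using (Injective)

-- Linear hypergraphs.  Points are Fin n (so |P| = n); the m lines are
-- given by an injective family L : Fin m → Subset n (a *set* of lines).

record IsLinearHypergraph {n m : ℕ} (L : Fin m → Subset n) : Set where
  field
    lines-distinct : Injective _≡_ _≡_ L
    line-two-points : ∀ i → Σ (Fin n) λ p → Σ (Fin n) λ q →
                        p ≢ q × p ∈ L i × q ∈ L i
    linear : ∀ (p q : Fin n) → p ≢ q → ∀ i j →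
               p ∈ L i → q ∈ L i → p ∈ L j → q ∈ L j → i ≡ j

Meet : {n : ℕ} → Subset n → Subset n → Set
Meet {n} l g = Σ (Fin n) λ p → p ∈ l × p ∈ g

IsLineColoring : {n m k : ℕ} → (Fin m → Subset n) → (Fin m → Fin k) → Set
IsLineColoring L c = ∀ i j → i ≢ j → Meet (L i) (L j) → c i ≢ c j

EFL : Set
EFL = ∀ (n m : ℕ) (L : Fin m → Subset n) → IsLinearHypergraph L →
        Σ (Fin m → Fin n) λ c → IsLineColoring L c

record Graph : Set where
  field
    V      : ℕ
    Adj    : Fin V → Fin V → Bool
    sym    : ∀ x y → Adj x y ≡ Adj y x
    irrefl : ∀ x → Adj x x ≡ false

open Graph public

Colorable : Graph → ℕ → Set
Colorable G k = Σ (Fin (V G) → Fin k) λ c →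
                  ∀ x y → Adj G x y ≡ true → c x ≢ c y

IsMin : (ℕ → Set) → ℕ → Set
IsMin P k = P k × (∀ j → P j → k ≤ j)

IsChromaticNumber : Graph → ℕ → Set
IsChromaticNumber G k = IsMin (Colorable G) k

IntersectionGraphIso : {n m : ℕ} → (Fin m → Subset n) → Graph → Set
IntersectionGraphIso {n} {m} L G =
  Σ (Fin m ⤖ Fin (V G)) λ f →
    ∀ i j → ((i ≢ j × Meet (L i) (L j)) ⇔
             (Adj G (Bijection.to f i) (Bijection.to f j) ≡ true))

Realizable : Graph → ℕ → Set
Realizable G n = Σ ℕ λ m → Σ (Fin m → Subset n) λ L →
                   IsLinearHypergraph L × IntersectionGraphIso L G

IsLinearIntersectionNumber : Graph → ℕ → Set
IsLinearIntersectionNumber G k = IsMin (Realizable G) k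

ChiLeV : Graph → Set
ChiLeV G = ∀ c v → IsChromaticNumber G c → IsLinearIntersectionNumber G v → c ≤ v

{-# OPTIONS --safe #-}
-- If L realises G as its intersection graph, colourings of G and line colourings of L
-- correspond; applying EFL to a realisation of G on v(G) points thus gives χ(G) ≤ v(G).
-- Conversely, a linear hypergraph on n points realises its own intersection graph G, so
-- v(G) ≤ n and hence χ(G) ≤ n.  The minima χ(G) and v(G) need not be computable, but they
-- exist up to double negation, and that suffices because colourability with n colours is
-- decidable by exhaustive search.
module Submission where

open import Defs hiding (sym)
open import Data.Nat using (ℕ; zero; suc; _≤_; _<_)
open import Data.Nat.Induction using (<-rec)
open import Data.Nat.Properties using (≮⇒≥; ≤-trans)
open import Data.Fin using (Fin; inject≤; _≟_)
open import Data.Fin.Properties using (any?; all?; inject≤-injective)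
open import Data.Fin.Subset using (Subset)
open import Data.Fin.Subset.Properties using (_∈?_)
open import Data.Bool using (true)
open import Data.Bool.Properties using () renaming (_≟_ to _≟ᵇ_)
open import Data.Vec using (Vec; []; _∷_; lookup; tabulate)
open import Data.Vec.Properties using (lookup∘tabulate)
open import Data.Product using (Σ; ∃; _×_; _,_; proj₁; proj₂)
open import Function.Bundles using (_⇔_; mk⇔; Equivalence; Bijection)
open import Function.Construct.Identity using (⤖-id)
open import Relation.Binary.PropositionalEquality
  using (_≡_; _≢_; refl; sym; subst; subst₂)
open import Relation.Nullary using (¬_; Dec; does; proof; Reflects; invert)
open import Relation.Nullary.Decidable
  using (map′; _×-dec_; _→-dec_; ¬?; dec-true; dec-false; does-⇔; decidable-stable)
open import Relation.Unary using (Decidable)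

¬¬-least : {P : ℕ → Set} {n : ℕ} → P n → ¬ ¬ ∃ (IsMin P)
¬¬-least {P} {n} pn noLeast = <-rec (λ k → ¬ P k) noneBelow n pn
  where
  noneBelow : ∀ k → (∀ {j} → j < k → ¬ P j) → ¬ P k
  noneBelow k below pk = noLeast (k , pk , λ j pj → ≮⇒≥ (λ j<k → below j<k pj))

Searchable : Set → Set₁
Searchable A = {P : A → Set} → Decidable P → Dec (∃ P)

searchable-Vec : {A : Set} → Searchable A → ∀ n → Searchable (Vec A n)
searchable-Vec search zero P? = map′ ([] ,_) (λ { ([] , p) → p }) (P? [])
searchable-Vec search (suc n) P? =
  map′ (λ (a , xs , p) → a ∷ xs , p) (λ { (a ∷ xs , p) → a , xs , p })
       (search (λ a → searchable-Vec search n (λ xs → P? (a ∷ xs))))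

IsProperColoring : (G : Graph) {k : ℕ} → (Fin (V G) → Fin k) → Set
IsProperColoring G c = ∀ x y → Adj G x y ≡ true → c x ≢ c y

isProperColoring? : (G : Graph) {k : ℕ} → Decidable (IsProperColoring G {k})
isProperColoring? G c =
  all? λ x → all? λ y → (Adj G x y ≟ᵇ true) →-dec ¬? (c x ≟ c y)

isProperColoring-cong : (G : Graph) {k : ℕ} {c d : Fin (V G) → Fin k} →
                        (∀ x → c x ≡ d x) → IsProperColoring G c → IsProperColoring G d
isProperColoring-cong G c≗d proper x y adj dx≡dy =
  proper x y adj (subst₂ _≡_ (sym (c≗d x)) (sym (c≗d y)) dx≡dy)

colorable? : (G : Graph) (k : ℕ) → Dec (Colorable G k)
colorable? G k =
  map′ (λ (cs , proper) → lookup cs , proper)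
       (λ (c , proper) → tabulate c ,
          isProperColoring-cong G (λ x → sym (lookup∘tabulate c x)) proper)
       (searchable-Vec any? (V G) (λ cs → isProperColoring? G (lookup cs)))

colorable-mono : (G : Graph) {k l : ℕ} → k ≤ l → Colorable G k → Colorable G l
colorable-mono G k≤l (c , proper) =
  (λ x → inject≤ (c x) k≤l) ,
  λ x y adj eq → proper x y adj (inject≤-injective k≤l k≤l _ _ eq)

LineColorable : {n m : ℕ} → (Fin m → Subset n) → ℕ → Set
LineColorable {m = m} L k = Σ (Fin m → Fin k) (IsLineColoring L)

module _ {n m : ℕ} (L : Fin m → Subset n) where
  Intersect : Fin m → Fin m → Set
  Intersect i j = i ≢ j × Meet (L i) (L j)

  intersect? : ∀ i j → Dec (Intersect i j)
  intersect? i j = ¬? (i ≟ j) ×-dec any? (λ p → (p ∈? L i) ×-dec (p ∈? L j))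

  intersect-sym : ∀ {i j} → Intersect i j → Intersect j i
  intersect-sym (i≢j , p , p∈Li , p∈Lj) = (λ j≡i → i≢j (sym j≡i)) , p , p∈Lj , p∈Li

  intersectionGraph : Graph
  intersectionGraph = record
    { V      = m
    ; Adj    = λ i j → does (intersect? i j)
    ; sym    = λ i j → does-⇔ (mk⇔ intersect-sym intersect-sym) (intersect? i j) (intersect? j i)
    ; irrefl = λ i → dec-false (intersect? i i) (λ (i≢i , _) → i≢i refl)
    }

  intersectionGraph-iso : IntersectionGraphIso L intersectionGraph
  intersectionGraph-iso =
    ⤖-id (Fin m) ,
    λ i j → mk⇔ (dec-true (intersect? i j))
                (λ adj → invert (subst (Reflects _) adj (proof (intersect? i j))))

module _ {n m : ℕ} {L : Fin m → Subset n} (G : Graph) (iso : IntersectionGraphIso L G) where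
  private
    open Bijection (proj₁ iso) using (to; to⁻; strictlySurjective)

    to∘to⁻ : ∀ x → to (to⁻ x) ≡ x
    to∘to⁻ x = proj₂ (strictlySurjective x)

    intersect⇔adjacent : ∀ i j → Intersect L i j ⇔ (Adj G (to i) (to j) ≡ true)
    intersect⇔adjacent = proj₂ iso

  colorable⇔lineColorable : ∀ {k} → Colorable G k ⇔ LineColorable L k
  colorable⇔lineColorable = mk⇔ fromColoring toColoring
    where
    fromColoring : ∀ {k} → Colorable G k → LineColorable L k
    fromColoring (c , proper) =
      (λ i → c (to i)) ,
      λ i j i≢j meet → proper (to i) (to j) (Equivalence.to (intersect⇔adjacent i j) (i≢j , meet))

    toColoring : ∀ {k} → LineColorable L k → Colorable G k
    toColoring (c , lineColoring) = (λ x → c (to⁻ x)) , proper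
      where
      proper : IsProperColoring G (λ x → c (to⁻ x))
      proper x y adj =
        let (i≢j , meet) = Equivalence.from (intersect⇔adjacent (to⁻ x) (to⁻ y)) adj′
        in lineColoring (to⁻ x) (to⁻ y) i≢j meet
        where
        adj′ : Adj G (to (to⁻ x)) (to (to⁻ y)) ≡ true
        adj′ = subst₂ (λ a b → Adj G a b ≡ true) (sym (to∘to⁻ x)) (sym (to∘to⁻ y)) adj

χ≤v-from-EFL : EFL → (G : Graph) → ChiLeV G
χ≤v-from-EFL efl G χ v (_ , χ-least) ((m , L , linear , iso) , _) =
  χ-least v (Equivalence.from (colorable⇔lineColorable G iso) (efl v m L linear))

EFL-from-χ≤v : ((G : Graph) → ChiLeV G) → EFL
EFL-from-χ≤v χ≤v n m L linear =
  Equivalence.to (colorable⇔lineColorable G iso) (decidable-stable (colorable? G n) ¬¬colorable)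
  where
  G : Graph
  G = intersectionGraph L

  iso : IntersectionGraphIso L G
  iso = intersectionGraph-iso L

  colorableWithLines : Colorable G m
  colorableWithLines = Equivalence.from (colorable⇔lineColorable G iso) ((λ i → i) , λ i j i≢j _ → i≢j)

  realizableWithPoints : Realizable G n
  realizableWithPoints = m , L , linear , iso

  ¬¬colorable : ¬ ¬ Colorable G n
  ¬¬colorable ¬colorable =
    ¬¬-least colorableWithLines λ (χ , isχ) →
    ¬¬-least realizableWithPoints λ (v , isv) →
    let χ≤n = ≤-trans (χ≤v G χ v isχ isv) (proj₂ isv n realizableWithPoints)
    in ¬colorable (colorable-mono G χ≤n (proj₁ isχ))

mainTheorem1 : EFL ⇔ (∀ (G : Graph) → ChiLeV G)
mainTheorem1 = mk⇔ χ≤v-from-EFL EFL-from-χ≤v
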